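{- Let $k$ and $m$ be positive integers. Let $H$ be a graph and $\prec$ a linear ordering of its vertices. Suppose that for each $v\in V(H)$, the induced subgraph $H[\{u\in V(H)\colon v\preceq u\}]$ is connected and has diameter at most $k$. Then $$\mathrm{wcol}_k(\mathcal{A}_{H,\prec,m})\ge\min\bigl(m,\mathrm{wcol}_{\prec,k}(H)\bigr).$$
   Context: Let $v_1\prec\cdots\prec v_n$ be the vertices of $H$ and $T$ the complete rooted $m$-ary tree of depth $n-1$; for $i\in\{1,\ldots,n\}$ let $T(v_i)$ be the set of vertices of $T$ at distance exactly $i-1$ from the root. The graph $\mathcal{A}_{H,\prec,m}$ has vertex set $V(T)$, with $x\in T(v_i)$ and $y\in T(v_j)$ adjacent iff $i\neq j$, $v_iv_j\in E(H)$, and $x$ is an ancestor of $y$ in $T$ or vice versa. For a linear ordering $\prec$ of a graph $G$ and integer $k\ge0$, $u$ is weakly $k$-reachable from $v$ if $u\preceq v$ and there is a path from $v$ to $u$ of length at most $k$ with all internal vertices greater than $u$; $\mathrm{wcol}_{\prec,k}(G)$ is the maximum over $v$ of the number of vertices weakly $k$-reachable from $v$, and $\mathrm{wcol}_k(G)=\min_\prec\mathrm{wcol}_{\prec,k}(G)$ over all linear orderings. -}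

module Defs where

open import Data.Nat using (ℕ; zero; suc; _≤_; _<_; _⊓_)
open import Data.Fin using (Fin; toℕ; inject₁; fromℕ)
open import Data.Vec using (Vec; toList)
open import Data.List using (List; _++_)
open import Data.Product using (Σ; ∃; _×_; _,_; proj₁; proj₂)
open import Data.Sum using (_⊎_)
open import Relation.Nullary using (¬_)
open import Relation.Binary.PropositionalEquality using (_≡_; _≢_)
open import Function.Definitions using (Injective)

record Graph (V : Set) : Set₁ where
  field
    E        : V → V → Set
    E-sym    : ∀ {x y} → E x y → E y x
    E-irrefl : ∀ {x} → ¬ E x x
open Graph public

-- A linear ordering of a (finite) vertex set V: an injective position map
-- into ℕ; u ≺ v iff pos u < pos v.
record LinOrd (V : Set) : Set where
  field
    pos     : V → ℕ
    pos-inj : Injective _≡_ _≡_ pos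
open LinOrd public

record Path {V : Set} (G : Graph V) (ℓ : ℕ) : Set where
  field
    vtx      : Fin (suc ℓ) → V
    vtx-inj  : Injective _≡_ _≡_ vtx
    vtx-adj  : (i : Fin ℓ) → E G (vtx (inject₁ i)) (vtx (Fin.suc i))
open Path public

first : ∀ {V} {G : Graph V} {ℓ} → Path G ℓ → V
first p = vtx p Fin.zero

last : ∀ {V} {G : Graph V} {ℓ} → Path G ℓ → V
last {ℓ = ℓ} p = vtx p (fromℕ ℓ)

Internal : ∀ {ℓ} → Fin (suc ℓ) → Set
Internal {ℓ} i = (0 < toℕ i) × (toℕ i < ℓ)

WReach : ∀ {V} → Graph V → LinOrd V → ℕ → V → V → Set
WReach G ≺ k v u =
  (pos ≺ u ≤ pos ≺ v) ×
  Σ ℕ λ ℓ → Σ (Path G ℓ) λ p →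
    (ℓ ≤ k) × (first p ≡ v) × (last p ≡ u) ×
    (∀ i → Internal i → pos ≺ u < pos ≺ (vtx p i))

AtLeast : {A : Set} → ℕ → (A → Set) → Set
AtLeast {A} c P = Σ (Fin c → Σ A P) λ f → Injective _≡_ _≡_ (λ i → proj₁ (f i))

-- wcol_{≺,k}(G) ≥ c   (max over v of #weakly k-reachable vertices is ≥ c)
WcolOrd≥ : ∀ {V} → Graph V → LinOrd V → ℕ → ℕ → Set
WcolOrd≥ {V} G ≺ k c = Σ V λ v → AtLeast c (WReach G ≺ k v)

-- wcol_k(G) ≥ c   (min over all linear orderings of wcol_{≺,k}(G) is ≥ c)
Wcol≥ : ∀ {V} → Graph V → ℕ → ℕ → Set
Wcol≥ {V} G k c = (≺ : LinOrd V) → WcolOrd≥ G ≺ k c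

-- H has vertex set Fin n, with v_1 ≺ ⋯ ≺ v_n given by the index order
-- (v_{i+1} is the element i : Fin n).

finOrd : (n : ℕ) → LinOrd (Fin n)
finOrd n = record { pos = toℕ ; pos-inj = Data.Fin.Properties.toℕ-injective }
  where import Data.Fin.Properties

-- Vertices of the complete rooted m-ary tree T of depth n-1, grouped by
-- depth: a vertex at depth i (i.e. in T(v_{i+1})) is a word of length i
-- over Fin m (the labels of the edges from the root).
AVertex : ℕ → ℕ → Set
AVertex n m = Σ (Fin n) λ i → Vec (Fin m) (toℕ i)

depth : ∀ {n m} → AVertex n m → Fin n
depth = proj₁

word : ∀ {n m} (x : AVertex n m) → List (Fin m)
word x = toList (proj₂ x)

Ancestor : ∀ {n m} → AVertex n m → AVertex n m → Set
Ancestor {m = m} x y = Σ (List (Fin m)) λ z → word x ++ z ≡ word y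

AEdge : ∀ {n} → Graph (Fin n) → (m : ℕ) → AVertex n m → AVertex n m → Set
AEdge H m x y =
  (depth x ≢ depth y) × E H (depth x) (depth y) × (Ancestor x y ⊎ Ancestor y x)

𝒜 : ∀ {n} → Graph (Fin n) → (m : ℕ) → Graph (AVertex n m)
𝒜 H m = record
  { E        = AEdge H m
  ; E-sym    = λ { (ne , e , a) → (λ eq → ne (sym eq)) , E-sym H e , swap a }
  ; E-irrefl = λ { (ne , _) → ne refl }
  }
  where
  open import Relation.Binary.PropositionalEquality using (sym; refl)
  open import Data.Sum using (swap)

-- H[{u : v ⪯ u}] is connected and has diameter at most k: any two vertices
-- a, b with v ⪯ a, v ⪯ b are joined by a path of length ≤ k all of whose
-- vertices u satisfy v ⪯ u.
UpperSetConnDiam≤ : ∀ {n} → Graph (Fin n) → ℕ → Fin n → Set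
UpperSetConnDiam≤ H k v =
  ∀ a b → toℕ v ≤ toℕ a → toℕ v ≤ toℕ b →
  Σ ℕ λ ℓ → Σ (Path H ℓ) λ p →
    (ℓ ≤ k) × (first p ≡ a) × (last p ≡ b) × (∀ i → toℕ v ≤ toℕ (vtx p i))

{-# OPTIONS --safe #-}
-- Given an ordering σ of 𝒜, walk down T from the root, moving to a child whose subtree has
-- its σ-minimum after the current vertex x.  If there is no such child, the m subtree minima
-- of the children of x all precede x, and each is weakly k-reachable from x: a path of H
-- inside the upper set of depth(x), lifted along a branch through the minimum, stays in that
-- child's subtree and hence after the minimum.  If the walk reaches a leaf, σ increases along
-- the branch it followed; this branch is a copy of (H, ≺) in 𝒜, so weak k-reachability lifts
-- and wcol_{σ,k}(𝒜) ≥ wcol_{≺,k}(H).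
module Submission where

open import Defs
open import Data.Nat using (ℕ; _⊓_; NonZero)
open import Data.Fin using (Fin)
open import Data.Nat using (zero; suc; pred; _≤_; _<_; z≤n; s≤s; s≤s⁻¹; z<s; s<s; _<?_)
open import Data.Nat.Properties
open import Data.Fin as Fin using (toℕ; fromℕ; inject₁; inject≤)
open import Data.Fin.Properties
  using (toℕ-injective; toℕ-fromℕ; toℕ-inject₁; toℕ≤pred[n]; ≤fromℕ; inject≤-injective; any?)
open import Data.Fin.Induction using (>-weakInduction)
open import Data.Vec using (Vec; []; _∷_; toList)
open import Data.Vec.Properties using (toList-injective; length-toList)
open import Data.Vec.Relation.Binary.Equality.Cast using (cast-is-id)
open import Data.List using (List; []; _∷_; _++_; _∷ʳ_; [_]; length; applyUpTo; allFin; map)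
open import Data.List.Properties
  using (++-identityʳ; ++-assoc; ++-cancelˡ; ∷-injectiveˡ; length-++; applyUpTo-∷ʳ)
open import Data.List.Membership.Propositional.Properties using (∈-map⁺; ∈-allFin)
import Data.List.Relation.Unary.All as All
open import Data.List.Extrema ≤-totalOrder using (argmin; f[argmin]≤f[⊤]; f[argmin]≤f[xs])
open import Data.Product using (Σ; ∃; ∃₂; _×_; _,_; proj₁; proj₂; map₂)
open import Data.Sum using (_⊎_; inj₁; inj₂; [_,_]′)
open import Function using (_∘_)
open import Function.Definitions using (Injective)
open import Relation.Nullary using (Dec; yes; no; contradiction)
open import Relation.Binary.PropositionalEquality
  using (_≡_; _≢_; refl; sym; trans; cong; cong₂; subst; subst₂; module ≡-Reasoning)

private
  variable
    A B : Set

prefix : (ℕ → A) → (k : ℕ) → Vec A k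
prefix g zero    = []
prefix g (suc k) = g 0 ∷ prefix (g ∘ suc) k

toList-prefix : (g : ℕ → A) (k : ℕ) → toList (prefix g k) ≡ applyUpTo g k
toList-prefix g zero    = refl
toList-prefix g (suc k) = cong (g 0 ∷_) (toList-prefix (g ∘ suc) k)

applyUpTo-cong : ∀ {g h : ℕ → A} k → (∀ {l} → l < k → g l ≡ h l) →
                 applyUpTo g k ≡ applyUpTo h k
applyUpTo-cong zero    _   = refl
applyUpTo-cong (suc k) g≗h = cong₂ _∷_ (g≗h z<s) (applyUpTo-cong k (g≗h ∘ s<s))

applyUpTo-isPrefix : (g : ℕ → A) {i k : ℕ} → i ≤ k →
                     ∃ λ z → applyUpTo g i ++ z ≡ applyUpTo g k
applyUpTo-isPrefix g {k = k} z≤n = applyUpTo g k , refl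
applyUpTo-isPrefix g (s≤s i≤k) = map₂ (cong (g 0 ∷_)) (applyUpTo-isPrefix (g ∘ suc) i≤k)

redirect : (ℕ → A) → ℕ → A → ℕ → A
redirect f d a l with l <? d
... | yes _ = f l
... | no  _ = a

redirect-< : (f : ℕ → A) {d : ℕ} {a : A} {l : ℕ} → l < d → redirect f d a l ≡ f l
redirect-< f {d} {l = l} l<d with l <? d
... | yes _   = refl
... | no  l≮d = contradiction l<d l≮d

redirect-at : (f : ℕ → A) (d : ℕ) (a : A) → redirect f d a d ≡ a
redirect-at f d a with d <? d
... | yes d<d = contradiction d<d (<-irrefl refl)
... | no  _   = refl

AtLeast-≤ : ∀ {P : A → Set} {a b} → a ≤ b → AtLeast b P → AtLeast a P
AtLeast-≤ a≤b (elems , distinct) =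
  elems ∘ (λ i → inject≤ i a≤b) , inject≤-injective a≤b a≤b _ _ ∘ distinct

AtLeast-map : ∀ {P : A → Set} {Q : B → Set} {c} (h : A → B) → Injective _≡_ _≡_ h →
              (∀ {x} → P x → Q (h x)) → AtLeast c P → AtLeast c Q
AtLeast-map h h-inj P⇒Q (elems , distinct) =
  (λ i → h (proj₁ (elems i)) , P⇒Q (proj₂ (elems i))) , distinct ∘ h-inj

internal≢first : ∀ {V} {G : Graph V} {ℓ} (p : Path G ℓ) {i} → Internal i → vtx p i ≢ first p
internal≢first p (0<i , _) eq = <-irrefl (sym (cong toℕ (vtx-inj p eq))) 0<i

internal≢last : ∀ {V} {G : Graph V} {ℓ} (p : Path G ℓ) {i} → Internal i → vtx p i ≢ last p
internal≢last {ℓ = ℓ} p (_ , i<ℓ) eq = <-irrefl (trans (cong toℕ (vtx-inj p eq)) (toℕ-fromℕ ℓ)) i<ℓ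

toℕ-suc≡1+toℕ-inject₁ : ∀ {n} (i : Fin n) → toℕ (Fin.suc i) ≡ suc (toℕ (inject₁ i))
toℕ-suc≡1+toℕ-inject₁ i = cong suc (sym (toℕ-inject₁ i))

module Tree {n m : ℕ} where

  Vertex : Set
  Vertex = AVertex n m

  Branch : Set
  Branch = ℕ → Fin m

  node : Branch → Fin n → Vertex
  node g j = j , prefix g (toℕ j)

  node-injective : ∀ {g} → Injective _≡_ _≡_ (node g)
  node-injective = cong depth

  word-node : ∀ g j → word (node g j) ≡ applyUpTo g (toℕ j)
  word-node g j = toList-prefix g (toℕ j)

  length-word : (x : Vertex) → length (word x) ≡ toℕ (depth x)
  length-word (_ , u) = length-toList u

  word-injective : ∀ {x y : Vertex} → word x ≡ word y → x ≡ y
  word-injective {i , u} {j , v} eq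
    with toℕ-injective (trans (sym (length-word (i , u))) (trans (cong length eq) (length-word (j , v))))
  ... | refl = cong (i ,_) (trans (sym (cast-is-id refl u)) (toList-injective refl u v eq))

  Ancestor-refl : (x : Vertex) → Ancestor x x
  Ancestor-refl x = [] , ++-identityʳ (word x)

  Ancestor-trans : ∀ {x y z : Vertex} → Ancestor x y → Ancestor y z → Ancestor x z
  Ancestor-trans {x} {y} {z} (a , xa≡y) (b , yb≡z) = a ++ b , (begin
    word x ++ a ++ b   ≡⟨ sym (++-assoc (word x) a b) ⟩
    (word x ++ a) ++ b ≡⟨ cong (_++ b) xa≡y ⟩
    word y ++ b        ≡⟨ yb≡z ⟩
    word z             ∎)
    where open ≡-Reasoning

  ancestor-cases : ∀ {x t : Vertex} → Ancestor x t →
                   t ≡ x ⊎ ∃₂ λ a z → word x ++ a ∷ z ≡ word t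
  ancestor-cases {x} ([] , eq)    = inj₁ (word-injective (trans (sym eq) (++-identityʳ (word x))))
  ancestor-cases     (a ∷ z , eq) = inj₂ (a , z , eq)

  depth-< : ∀ {x t : Vertex} {a z} → word x ++ a ∷ z ≡ word t → toℕ (depth x) < toℕ (depth t)
  depth-< {x} {t} {z = z} eq = subst₂ _<_ (length-word x) (trans (cong length eq) (length-word t))
    (subst (length (word x) <_) (sym (length-++ (word x))) (m<m+n (length (word x)) z<s))

  descendant-of-leaf : ∀ {x t : Vertex} → pred n ≤ toℕ (depth x) → Ancestor x t → t ≡ x
  descendant-of-leaf {x} {t} leaf x≤t with ancestor-cases x≤t
  ... | inj₁ t≡x = t≡x
  ... | inj₂ (_ , _ , eq) = contradiction (<-≤-trans (depth-< eq) (toℕ≤pred[n] (depth t)))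
                                          (≤⇒≯ leaf)

  children-disjoint : ∀ {x t : Vertex} {a b y z} →
                      word x ++ a ∷ y ≡ word t → word x ++ b ∷ z ≡ word t → a ≡ b
  children-disjoint {x} eq₁ eq₂ = ∷-injectiveˡ (++-cancelˡ (word x) _ _ (trans eq₁ (sym eq₂)))

  node-ancestor : ∀ g {i j} → toℕ i ≤ toℕ j → Ancestor (node g i) (node g j)
  node-ancestor g {i} {j} i≤j with applyUpTo-isPrefix g i≤j
  ... | z , eq = z , trans (cong (_++ z) (word-node g i)) (trans eq (sym (word-node g j)))

  node-cong : ∀ {g h} j → (∀ {l} → l < toℕ j → g l ≡ h l) → node g j ≡ node h j
  node-cong {g} {h} j g≗h =
    word-injective (trans (word-node g j) (trans (applyUpTo-cong (toℕ j) g≗h) (sym (word-node h j))))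

  node-redirect : ∀ f {d a} j → toℕ j ≤ d → node (redirect f d a) j ≡ node f j
  node-redirect f j j≤d = node-cong j (λ l<j → redirect-< f (<-≤-trans l<j j≤d))

  module Children (f : Branch) {d d′ : Fin n} (d′≡1+d : toℕ d′ ≡ suc (toℕ d)) (a : Fin m) where

    childBranch : Branch
    childBranch = redirect f (toℕ d) a

    child : Vertex
    child = node childBranch d′

    word-child : word child ≡ word (node f d) ∷ʳ a
    word-child = begin
      word child                                          ≡⟨ word-node childBranch d′ ⟩
      applyUpTo childBranch (toℕ d′)                      ≡⟨ cong (applyUpTo childBranch) d′≡1+d ⟩
      applyUpTo childBranch (suc (toℕ d))                 ≡⟨ sym (applyUpTo-∷ʳ childBranch (toℕ d)) ⟩
      applyUpTo childBranch (toℕ d) ∷ʳ childBranch (toℕ d)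
        ≡⟨ cong₂ _∷ʳ_ (applyUpTo-cong (toℕ d) (redirect-< f)) (redirect-at f (toℕ d) a) ⟩
      applyUpTo f (toℕ d) ∷ʳ a                            ≡⟨ cong (_∷ʳ a) (sym (word-node f d)) ⟩
      word (node f d) ∷ʳ a                                ∎
      where open ≡-Reasoning

    parent-ancestor : Ancestor (node f d) child
    parent-ancestor = [ a ] , sym word-child

    child-ancestor⁺ : ∀ {t z} → word (node f d) ++ a ∷ z ≡ word t → Ancestor child t
    child-ancestor⁺ {z = z} eq =
      z , trans (cong (_++ z) word-child) (trans (++-assoc (word (node f d)) [ a ] z) eq)

    child-ancestor⁻ : ∀ {t} → Ancestor child t → ∃ λ z → word (node f d) ++ a ∷ z ≡ word t
    child-ancestor⁻ (z , eq) =
      z , trans (sym (++-assoc (word (node f d)) [ a ] z)) (trans (cong (_++ z) (sym word-child)) eq)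

module _ {n m : ℕ} (H : Graph (Fin n)) where
  open Tree {n} {m}

  liftPath : ∀ {ℓ} → Branch → Path H ℓ → Path (𝒜 H m) ℓ
  liftPath g p = record
    { vtx     = node g ∘ vtx p
    ; vtx-inj = vtx-inj p ∘ node-injective
    ; vtx-adj = λ i → node-edge (vtx-adj p i)
    }
    where
    node-edge : ∀ {i j} → E H i j → AEdge H m (node g i) (node g j)
    node-edge {i} {j} e =
      (λ { refl → E-irrefl H e }) , e ,
      [ inj₁ ∘ node-ancestor g , inj₂ ∘ node-ancestor g ]′ (≤-total (toℕ i) (toℕ j))

  module _ (σ : LinOrd Vertex) where

    Increasing : Branch → Set
    Increasing g = ∀ {i j} → toℕ i < toℕ j → pos σ (node g i) < pos σ (node g j)

    WReach-lift : ∀ {k g} → Increasing g → ∀ {v u} →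
                  WReach H (finOrd n) k v u → WReach (𝒜 H m) σ k (node g v) (node g u)
    WReach-lift {g = g} increasing {v} {u} (u≤v , ℓ , p , ℓ≤k , first≡v , last≡u , internal) =
      ≤-rank (m≤n⇒m<n∨m≡n u≤v) , ℓ , liftPath g p , ℓ≤k ,
      cong (node g) first≡v , cong (node g) last≡u , λ i → increasing ∘ internal i
      where
      ≤-rank : toℕ u < toℕ v ⊎ toℕ u ≡ toℕ v → pos σ (node g u) ≤ pos σ (node g v)
      ≤-rank (inj₁ u<v) = <⇒≤ (increasing u<v)
      ≤-rank (inj₂ u≡v) = ≤-reflexive (cong (pos σ ∘ node g) (toℕ-injective u≡v))

module Descent {n′ m : ℕ} (H : Graph (Fin (suc n′))) (σ : LinOrd (AVertex (suc n′) m)) {k : ℕ}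
               (conn : ∀ v → UpperSetConnDiam≤ H k v) where
  open Tree {suc n′} {m}

  infix 4 _≤σ_ _<σ_

  _≤σ_ _<σ_ : Vertex → Vertex → Set
  x ≤σ y = pos σ x ≤ pos σ y
  x <σ y = pos σ x < pos σ y

  ≤σ∧≢⇒<σ : ∀ {x y} → x ≤σ y → x ≢ y → x <σ y
  ≤σ∧≢⇒<σ x≤y x≢y = ≤∧≢⇒< x≤y (x≢y ∘ pos-inj σ)

  record Descendant (f : Branch) (d : Fin (suc n′)) : Set where
    field
      branch : Branch
      level  : Fin (suc n′)
      deeper : toℕ d ≤ toℕ level
      agrees : ∀ {l} → l < toℕ d → branch l ≡ f l

    vertex : Vertex
    vertex = node branch level

    node-branch : node branch d ≡ node f d
    node-branch = node-cong d agrees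

    ancestor : Ancestor (node f d) vertex
    ancestor = subst (λ x → Ancestor x vertex) node-branch (node-ancestor branch deeper)

  open Descendant

  root : ∀ f d → Descendant f d
  root f d = record { branch = f ; level = d ; deeper = ≤-refl ; agrees = λ _ → refl }

  record SubtreeMin (f : Branch) (d : Fin (suc n′)) : Set where
    field
      least   : Descendant f d
      minimal : ∀ {t} → Ancestor (node f d) t → vertex least ≤σ t
  open SubtreeMin

  PrecedesSubtrees : Branch → Fin (suc n′) → Set
  PrecedesSubtrees f d =
    ∀ {i j} → toℕ i < toℕ j → toℕ j ≤ toℕ d → ∀ {t} → Ancestor (node f j) t → node f i <σ t

  PrecedesSubtrees-root : ∀ f → PrecedesSubtrees f Fin.zero
  PrecedesSubtrees-root f i<j j≤0 = contradiction (<-≤-trans i<j j≤0) n≮0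

  module ChildSubtrees (f : Branch) {d d′ : Fin (suc n′)} (d′≡1+d : toℕ d′ ≡ suc (toℕ d)) where
    open Children f d′≡1+d public

    lift : ∀ {a} → Descendant (childBranch a) d′ → Descendant f d
    lift c = record
      { branch = branch c
      ; level  = level c
      ; deeper = ≤-trans (n≤1+n _) (subst (_≤ toℕ (level c)) d′≡1+d (deeper c))
      ; agrees = λ {l} l<d → trans (agrees c (subst (l <_) (sym d′≡1+d) (m<n⇒m<1+n l<d))) (redirect-< f l<d)
      }

    minima-distinct : ∀ {a b} (s : SubtreeMin (childBranch a) d′) (s′ : SubtreeMin (childBranch b) d′) →
                      vertex (least s) ≡ vertex (least s′) → a ≡ b
    minima-distinct {a} {b} s s′ y≡y′
      with child-ancestor⁻ a (ancestor (least s)) | child-ancestor⁻ b (ancestor (least s′))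
    ... | _ , eq | _ , eq′ = children-disjoint eq (trans eq′ (cong word (sym y≡y′)))

    -- the internal vertices lie deeper than d on the branch through the minimum, so in its subtree
    reach-min : ∀ {a} (s : SubtreeMin (childBranch a) d′) → vertex (least s) ≤σ node f d →
                WReach (𝒜 H m) σ k (node f d) (vertex (least s))
    reach-min {a} s y≤x = via (conn d d (level c) ≤-refl (deeper (lift c)))
      where
      c = least s
      g = branch c
      e = level c
      via : (Σ ℕ λ ℓ → Σ (Path H ℓ) λ p → (ℓ ≤ k) × (first p ≡ d) × (last p ≡ e) ×
              (∀ j → toℕ d ≤ toℕ (vtx p j))) →
            WReach (𝒜 H m) σ k (node f d) (vertex c)
      via (ℓ , p , ℓ≤k , first≡d , last≡e , upper) =
        y≤x , ℓ , liftPath H g p , ℓ≤k , trans (cong (node g) first≡d) (node-branch (lift c)) ,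
        cong (node g) last≡e , internal
        where
        internal : ∀ j → Internal j → vertex c <σ node g (vtx p j)
        internal j int =
          ≤σ∧≢⇒<σ (minimal s (subst (λ x → Ancestor x _) (node-branch c) (node-ancestor g d′≤u)))
                  (u≢e ∘ sym ∘ node-injective)
          where
          u≢d : vtx p j ≢ d
          u≢d eq = internal≢first p int (trans eq (sym first≡d))
          u≢e : vtx p j ≢ e
          u≢e eq = internal≢last p int (trans eq (sym last≡e))
          d′≤u : toℕ d′ ≤ toℕ (vtx p j)
          d′≤u = subst (_≤ toℕ (vtx p j)) (sym d′≡1+d) (≤∧≢⇒< (upper j) (u≢d ∘ sym ∘ toℕ-injective))

    precedes-child : ∀ {a} (s : SubtreeMin (childBranch a) d′) → PrecedesSubtrees f d →
                     node f d <σ vertex (least s) → PrecedesSubtrees (childBranch a) d′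
    precedes-child {a} s inv x<y {i} {j} i<j j≤d′ {t} anc =
      subst (_<σ t) (sym (node-redirect f i i≤d)) (cases (m≤n⇒m<n∨m≡n j≤d′))
      where
      i≤d : toℕ i ≤ toℕ d
      i≤d = s≤s⁻¹ (subst (toℕ i <_) d′≡1+d (<-≤-trans i<j j≤d′))
      cases : toℕ j < toℕ d′ ⊎ toℕ j ≡ toℕ d′ → node f i <σ t
      cases (inj₁ j<d′) = inv i<j j≤d (subst (λ x → Ancestor x t) (node-redirect f j j≤d) anc)
        where
        j≤d : toℕ j ≤ toℕ d
        j≤d = s≤s⁻¹ (subst (toℕ j <_) d′≡1+d j<d′)
      cases (inj₂ j≡d′) = [ below-parent , at-parent ]′ (m≤n⇒m<n∨m≡n i≤d)
        where
        anc′ : Ancestor (child a) t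
        anc′ = subst (λ j → Ancestor (node (childBranch a) j) t) (toℕ-injective j≡d′) anc
        below-parent : toℕ i < toℕ d → node f i <σ t
        below-parent i<d = inv i<d ≤-refl (Ancestor-trans (parent-ancestor a) anc′)
        at-parent : toℕ i ≡ toℕ d → node f i <σ t
        at-parent i≡d = subst (_<σ t) (cong (node f) (sym (toℕ-injective i≡d)))
                              (<-≤-trans x<y (minimal s anc′))

  subtreeMin : ∀ d f → SubtreeMin f d
  subtreeMin = >-weakInduction (λ d → ∀ f → SubtreeMin f d) atLeaf fromChildren
    where
    atLeaf : ∀ f → SubtreeMin f (fromℕ n′)
    atLeaf f = record
      { least   = root f (fromℕ n′)
      ; minimal = ≤-reflexive ∘ cong (pos σ) ∘ sym ∘ descendant-of-leaf (≤-reflexive (sym (toℕ-fromℕ n′)))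
      }

    fromChildren : ∀ i → (∀ f → SubtreeMin f (Fin.suc i)) → ∀ f → SubtreeMin f (inject₁ i)
    fromChildren i childMin f = record { least = best ; minimal = best-minimal }
      where
      open ChildSubtrees f (toℕ-suc≡1+toℕ-inject₁ i)

      here : Descendant f (inject₁ i)
      here = root f (inject₁ i)

      candidates : List (Descendant f (inject₁ i))
      candidates = map (λ a → lift (least (childMin (childBranch a)))) (allFin m)

      rank : Descendant f (inject₁ i) → ℕ
      rank = pos σ ∘ vertex

      best : Descendant f (inject₁ i)
      best = argmin rank here candidates

      best-minimal : ∀ {t} → Ancestor (node f (inject₁ i)) t → vertex best ≤σ t
      best-minimal anc with ancestor-cases anc
      ... | inj₁ refl = f[argmin]≤f[⊤] {f = rank} here candidates
      ... | inj₂ (a , z , eq) = ≤-trans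
        (All.lookup (f[argmin]≤f[xs] {f = rank} here candidates) (∈-map⁺ _ (∈-allFin a)))
        (minimal (childMin (childBranch a)) (child-ancestor⁺ a eq))

  Outcome : Set
  Outcome = WcolOrd≥ (𝒜 H m) σ k m ⊎ ∃ (Increasing H σ)

  descend : ∀ d f → PrecedesSubtrees f d → Outcome
  descend = >-weakInduction (λ d → ∀ f → PrecedesSubtrees f d → Outcome) atLeaf fromChild
    where
    atLeaf : ∀ f → PrecedesSubtrees f (fromℕ n′) → Outcome
    atLeaf f inv = inj₂ (f , λ {_} {j} i<j → inv i<j (≤fromℕ j) (Ancestor-refl (node f j)))

    fromChild : ∀ i → (∀ f → PrecedesSubtrees f (Fin.suc i) → Outcome) →
                ∀ f → PrecedesSubtrees f (inject₁ i) → Outcome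
    fromChild i descendChild f inv = decide (any? λ a → pos σ x <? pos σ (minimum a))
      where
      open ChildSubtrees f (toℕ-suc≡1+toℕ-inject₁ i)
      x : Vertex
      x = node f (inject₁ i)
      childMin : ∀ a → SubtreeMin (childBranch a) (Fin.suc i)
      childMin a = subtreeMin (Fin.suc i) (childBranch a)
      minimum : Fin m → Vertex
      minimum a = vertex (least (childMin a))
      decide : Dec (∃ λ a → x <σ minimum a) → Outcome
      decide (yes (a , x<y)) = descendChild (childBranch a) (precedes-child (childMin a) inv x<y)
      decide (no ∄x<y)       = inj₁ (x ,
        (λ a → minimum a , reach-min (childMin a) (≮⇒≥ (∄x<y ∘ (a ,_)))) ,
        minima-distinct (childMin _) (childMin _))

lemma9 : (k m n : ℕ) → .{{NonZero k}} → .{{NonZero m}} →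
    (H : Graph (Fin n)) →
    (∀ v → UpperSetConnDiam≤ H k v) →
    ∀ c → WcolOrd≥ H (finOrd n) k c →
    Wcol≥ (𝒜 H m) k (m ⊓ c)
lemma9 k m       zero     H conn c (() , _)
lemma9 k (suc m) (suc n′) H conn c (v , reachable) σ
  with descend Fin.zero (λ _ → Fin.zero) (PrecedesSubtrees-root _)
  where open Descent H σ conn
... | inj₁ (x , many)       = x , AtLeast-≤ (m⊓n≤m (suc m) c) many
... | inj₂ (g , increasing) = node g v , AtLeast-≤ (m⊓n≤n (suc m) c)
  (AtLeast-map (node g) node-injective (WReach-lift H σ increasing) reachable)
  where open Tree
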